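{- Let $p\ge1$, $q\ge1$, $i\in\{0,\dots,p-1\}$, and let $F_i\subseteq E$ be such that for every $\emptyset\ne A\subsetneq V$ with $|\delta_{F_i}(A)|=p+q-1$ we have $|\delta_{F_i\cap\mathcal{S}}(A)|\ge i$. Let $\mathcal{C}_i=\{\emptyset\ne A\subsetneq V : |\delta_{F_i}(A)|=p+q-1,\ |\delta_{F_i\cap\mathcal{S}}(A)|=i\}$. If $A,B\in\mathcal{C}_i$ and either (1) $|\delta_{F_i}(A\cap B)|=|\delta_{F_i}(A\cup B)|=p+q-1$, or (2) $|\delta_{F_i}(A\setminus B)|=|\delta_{F_i}(B\setminus A)|=p+q-1$, then $A$ and $B$ uncross, i.e., $A\cap B, A\cup B\in\mathcal{C}_i$ or $A\setminus B, B\setminus A\in\mathcal{C}_i$.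
   Context: $G=(V,E)$ is an undirected (multi)graph whose edges are partitioned into safe edges $\mathcal{S}$ and unsafe edges $\mathcal{U}$; $\delta_F(A)$ denotes the set of edges of $F$ with exactly one endpoint in $A$. -}

module Defs where

open import Data.Nat using (ℕ; _+_; _∸_)
open import Data.Bool using (Bool; _∧_; _xor_)
open import Data.Fin using (Fin)
open import Data.Product using (_×_; proj₁; proj₂)
open import Data.Vec using (lookup; tabulate)
open import Data.Fin.Subset using (Subset; _∩_; Nonempty; ⊤; ∣_∣)
open import Relation.Binary.PropositionalEquality using (_≢_; _≡_)

-- A multigraph G = (V, E) with V = Fin n and E = Fin m; edge e has endpoints
-- ends e (loops and parallel edges allowed). Safe edges 𝒮 are a Subset m;
-- unsafe edges are the complement.
record MultiGraph : Set where
  field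
    n    : ℕ
    m    : ℕ
    ends : Fin m → Fin n × Fin n
    𝒮    : Subset m

open MultiGraph public

δ : (G : MultiGraph) → Subset (m G) → Subset (n G) → Subset (m G)
δ G F A = tabulate λ e →
  lookup F e ∧ (lookup A (proj₁ (ends G e)) xor lookup A (proj₂ (ends G e)))

NonTrivial : (G : MultiGraph) → Subset (n G) → Set
NonTrivial G A = Nonempty A × (A ≢ ⊤)

InC : (G : MultiGraph) (p q i : ℕ) (F : Subset (m G)) → Subset (n G) → Set
InC G p q i F A =
  NonTrivial G A × (∣ δ G F A ∣ ≡ p + q ∸ 1) × (∣ δ G (F ∩ 𝒮 G) A ∣ ≡ i)

{-# OPTIONS --safe #-}
-- Both cut functions X ↦ |δ_F(X)| and X ↦ |δ_{F∩𝒮}(X)| are submodular and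
-- posimodular, since the cut function of a single edge is.  If the uncrossed
-- pair (X, Y) is tight for F, then both X and Y are nontrivial (their cut is
-- nonempty), so by hypothesis each has at least i safe cut edges; but
-- |δ_{F∩𝒮}(X)| + |δ_{F∩𝒮}(Y)| ≤ |δ_{F∩𝒮}(A)| + |δ_{F∩𝒮}(B)| = i + i,
-- so both have exactly i.
module Submission where

open import Defs
open import Data.Nat using (ℕ; _+_; _∸_; _≤_; _<_; _≥_)
open import Data.Product using (_×_)
open import Data.Sum using (_⊎_)
open import Data.Fin.Subset using (Subset; _∩_; _∪_; _─_; ∣_∣)
open import Relation.Binary.PropositionalEquality using (_≡_)

open import Algebra.Properties.CommutativeSemigroup using (interchange)
open import Data.Bool using (Bool; true; false; not; _∧_; _∨_; _xor_)
open import Data.Bool.Properties using (∧-zeroʳ; ∧-identityʳ; xor-same)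
open import Data.Fin using (Fin; zero; suc)
open import Data.Fin.Subset using (⊥; inside; outside; Nonempty)
open import Data.Fin.Subset.Properties using (∣⊥∣≡0; Empty-unique; nonempty?)
open import Data.Nat using (suc; z≤n)
open import Data.Nat.Properties
  using (≤-antisym; ≤-trans; +-mono-≤; +-monoˡ-≤; +-monoʳ-≤; +-cancelˡ-≤; +-cancelʳ-≤;
         +-commutativeSemigroup; +-suc; 1+n≢0; ≤ᵇ⇒≤; module ≤-Reasoning)
open import Data.Product using (_,_; proj₁; proj₂)
open import Data.Sum using (inj₁; inj₂)
open import Data.Vec using (_∷_; lookup; tabulate; replicate)
open import Data.Vec.Properties
  using (lookup-zipWith; lookup-replicate; tabulate-cong; tabulate∘lookup)
open import Function using (_∘_)
open import Relation.Nullary.Decidable using (decidable-stable)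
open import Relation.Binary.PropositionalEquality
  using (_≢_; refl; sym; trans; cong; cong₂; subst; subst₂; module ≡-Reasoning)

toℕ : Bool → ℕ
toℕ false = 0
toℕ true  = 1

∣x∷p∣≡toℕx+∣p∣ : ∀ {k} x (p : Subset k) → ∣ x ∷ p ∣ ≡ toℕ x + ∣ p ∣
∣x∷p∣≡toℕx+∣p∣ false p = refl
∣x∷p∣≡toℕx+∣p∣ true  p = refl

∣tabulate∣-+-mono : ∀ {k} (f g h l : Fin k → Bool) →
  (∀ e → toℕ (f e) + toℕ (g e) ≤ toℕ (h e) + toℕ (l e)) →
  ∣ tabulate f ∣ + ∣ tabulate g ∣ ≤ ∣ tabulate h ∣ + ∣ tabulate l ∣
∣tabulate∣-+-mono {0}     f g h l le = z≤n
∣tabulate∣-+-mono {suc k} f g h l le = begin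
  ∣ tabulate f ∣ + ∣ tabulate g ∣
    ≡⟨ cong₂ _+_ (∣x∷p∣≡toℕx+∣p∣ (f zero) (tabulate (f ∘ suc)))
                 (∣x∷p∣≡toℕx+∣p∣ (g zero) (tabulate (g ∘ suc))) ⟩
  (toℕ (f zero) + ∣ tabulate (f ∘ suc) ∣) + (toℕ (g zero) + ∣ tabulate (g ∘ suc) ∣)
    ≡⟨ interchange +-commutativeSemigroup (toℕ (f zero)) _ (toℕ (g zero)) _ ⟩
  (toℕ (f zero) + toℕ (g zero)) + (∣ tabulate (f ∘ suc) ∣ + ∣ tabulate (g ∘ suc) ∣)
    ≤⟨ +-mono-≤ (le zero) (∣tabulate∣-+-mono (f ∘ suc) (g ∘ suc) (h ∘ suc) (l ∘ suc) (le ∘ suc)) ⟩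
  (toℕ (h zero) + toℕ (l zero)) + (∣ tabulate (h ∘ suc) ∣ + ∣ tabulate (l ∘ suc) ∣)
    ≡⟨ interchange +-commutativeSemigroup (toℕ (h zero)) _ (toℕ (l zero)) _ ⟨
  (toℕ (h zero) + ∣ tabulate (h ∘ suc) ∣) + (toℕ (l zero) + ∣ tabulate (l ∘ suc) ∣)
    ≡⟨ cong₂ _+_ (∣x∷p∣≡toℕx+∣p∣ (h zero) (tabulate (h ∘ suc)))
                 (∣x∷p∣≡toℕx+∣p∣ (l zero) (tabulate (l ∘ suc))) ⟨
  ∣ tabulate h ∣ + ∣ tabulate l ∣ ∎
  where open ≤-Reasoning

lookup-─ : ∀ {k} (p q : Subset k) x → lookup (p ─ q) x ≡ lookup p x ∧ not (lookup q x)
lookup-─ (s ∷ p) (inside  ∷ q) zero    = sym (∧-zeroʳ s)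
lookup-─ (s ∷ p) (outside ∷ q) zero    = sym (∧-identityʳ s)
lookup-─ (_ ∷ p) (_       ∷ q) (suc x) = lookup-─ p q x

∧-+-mono : ∀ b {x y z w} → toℕ x + toℕ y ≤ toℕ z + toℕ w →
  toℕ (b ∧ x) + toℕ (b ∧ y) ≤ toℕ (b ∧ z) + toℕ (b ∧ w)
∧-+-mono false _  = z≤n
∧-+-mono true  le = le

-- aⱼ (bⱼ) records whether the j-th end of an edge lies in A (B).
edge-submodular : ∀ a₁ a₂ b₁ b₂ →
  toℕ ((a₁ ∧ b₁) xor (a₂ ∧ b₂)) + toℕ ((a₁ ∨ b₁) xor (a₂ ∨ b₂))
    ≤ toℕ (a₁ xor a₂) + toℕ (b₁ xor b₂)
edge-submodular true  true  true  true  = ≤ᵇ⇒≤ _ _ _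
edge-submodular true  true  true  false = ≤ᵇ⇒≤ _ _ _
edge-submodular true  true  false true  = ≤ᵇ⇒≤ _ _ _
edge-submodular true  true  false false = ≤ᵇ⇒≤ _ _ _
edge-submodular true  false true  true  = ≤ᵇ⇒≤ _ _ _
edge-submodular true  false true  false = ≤ᵇ⇒≤ _ _ _
edge-submodular true  false false true  = ≤ᵇ⇒≤ _ _ _
edge-submodular true  false false false = ≤ᵇ⇒≤ _ _ _
edge-submodular false true  true  true  = ≤ᵇ⇒≤ _ _ _
edge-submodular false true  true  false = ≤ᵇ⇒≤ _ _ _
edge-submodular false true  false true  = ≤ᵇ⇒≤ _ _ _
edge-submodular false true  false false = ≤ᵇ⇒≤ _ _ _
edge-submodular false false true  true  = ≤ᵇ⇒≤ _ _ _
edge-submodular false false true  false = ≤ᵇ⇒≤ _ _ _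
edge-submodular false false false true  = ≤ᵇ⇒≤ _ _ _
edge-submodular false false false false = ≤ᵇ⇒≤ _ _ _

edge-posimodular : ∀ a₁ a₂ b₁ b₂ →
  toℕ ((a₁ ∧ not b₁) xor (a₂ ∧ not b₂)) + toℕ ((b₁ ∧ not a₁) xor (b₂ ∧ not a₂))
    ≤ toℕ (a₁ xor a₂) + toℕ (b₁ xor b₂)
edge-posimodular true  true  true  true  = ≤ᵇ⇒≤ _ _ _
edge-posimodular true  true  true  false = ≤ᵇ⇒≤ _ _ _
edge-posimodular true  true  false true  = ≤ᵇ⇒≤ _ _ _
edge-posimodular true  true  false false = ≤ᵇ⇒≤ _ _ _
edge-posimodular true  false true  true  = ≤ᵇ⇒≤ _ _ _
edge-posimodular true  false true  false = ≤ᵇ⇒≤ _ _ _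
edge-posimodular true  false false true  = ≤ᵇ⇒≤ _ _ _
edge-posimodular true  false false false = ≤ᵇ⇒≤ _ _ _
edge-posimodular false true  true  true  = ≤ᵇ⇒≤ _ _ _
edge-posimodular false true  true  false = ≤ᵇ⇒≤ _ _ _
edge-posimodular false true  false true  = ≤ᵇ⇒≤ _ _ _
edge-posimodular false true  false false = ≤ᵇ⇒≤ _ _ _
edge-posimodular false false true  true  = ≤ᵇ⇒≤ _ _ _
edge-posimodular false false true  false = ≤ᵇ⇒≤ _ _ _
edge-posimodular false false false true  = ≤ᵇ⇒≤ _ _ _
edge-posimodular false false false false = ≤ᵇ⇒≤ _ _ _

module _ (G : MultiGraph) (F : Subset (m G)) where

  end₁ end₂ : Fin (m G) → Fin (n G)
  end₁ = proj₁ ∘ ends G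
  end₂ = proj₂ ∘ ends G

  crosses : (Fin (n G) → Bool) → Fin (m G) → Bool
  crosses A e = A (end₁ e) xor A (end₂ e)

  crosses-cong : ∀ {A B} → (∀ x → A x ≡ B x) → ∀ e → crosses A e ≡ crosses B e
  crosses-cong A≗B e = cong₂ _xor_ (A≗B (end₁ e)) (A≗B (end₂ e))

  ∣δ∣-+-mono : ∀ {A B C D} →
    (∀ e → toℕ (crosses (lookup C) e) + toℕ (crosses (lookup D) e)
             ≤ toℕ (crosses (lookup A) e) + toℕ (crosses (lookup B) e)) →
    ∣ δ G F C ∣ + ∣ δ G F D ∣ ≤ ∣ δ G F A ∣ + ∣ δ G F B ∣
  ∣δ∣-+-mono le = ∣tabulate∣-+-mono _ _ _ _ (λ e → ∧-+-mono (lookup F e) (le e))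

  ∣δ∣-submodular : ∀ A B → ∣ δ G F (A ∩ B) ∣ + ∣ δ G F (A ∪ B) ∣ ≤ ∣ δ G F A ∣ + ∣ δ G F B ∣
  ∣δ∣-submodular A B = ∣δ∣-+-mono {A} {B} {A ∩ B} {A ∪ B} λ e →
    subst₂ (λ c d → toℕ c + toℕ d ≤ toℕ (crosses (lookup A) e) + toℕ (crosses (lookup B) e))
      (crosses-cong (λ x → sym (lookup-zipWith _∧_ x A B)) e)
      (crosses-cong (λ x → sym (lookup-zipWith _∨_ x A B)) e)
      (edge-submodular (lookup A (end₁ e)) (lookup A (end₂ e)) (lookup B (end₁ e)) (lookup B (end₂ e)))

  ∣δ∣-posimodular : ∀ A B → ∣ δ G F (A ─ B) ∣ + ∣ δ G F (B ─ A) ∣ ≤ ∣ δ G F A ∣ + ∣ δ G F B ∣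
  ∣δ∣-posimodular A B = ∣δ∣-+-mono {A} {B} {A ─ B} {B ─ A} λ e →
    subst₂ (λ c d → toℕ c + toℕ d ≤ toℕ (crosses (lookup A) e) + toℕ (crosses (lookup B) e))
      (crosses-cong (λ x → sym (lookup-─ A B x)) e)
      (crosses-cong (λ x → sym (lookup-─ B A x)) e)
      (edge-posimodular (lookup A (end₁ e)) (lookup A (end₂ e)) (lookup B (end₁ e)) (lookup B (end₂ e)))

  ∣δ-replicate∣≡0 : ∀ b → ∣ δ G F (replicate (n G) b) ∣ ≡ 0
  ∣δ-replicate∣≡0 b = begin
    ∣ δ G F (replicate _ b) ∣        ≡⟨ cong ∣_∣ (tabulate-cong no-edge-crosses) ⟩
    ∣ tabulate (lookup (⊥ {m G})) ∣  ≡⟨ cong ∣_∣ (tabulate∘lookup (⊥ {m G})) ⟩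
    ∣ ⊥ {m G} ∣                      ≡⟨ ∣⊥∣≡0 (m G) ⟩
    0                                ∎
    where
    open ≡-Reasoning
    no-edge-crosses : ∀ e → lookup F e ∧ crosses (lookup (replicate _ b)) e ≡ lookup (⊥ {m G}) e
    no-edge-crosses e = begin
      lookup F e ∧ crosses (lookup (replicate _ b)) e
        ≡⟨ cong (lookup F e ∧_) (crosses-cong (λ x → lookup-replicate x b) e) ⟩
      lookup F e ∧ (b xor b)  ≡⟨ cong (lookup F e ∧_) (xor-same b) ⟩
      lookup F e ∧ false      ≡⟨ ∧-zeroʳ (lookup F e) ⟩
      false                   ≡⟨ lookup-replicate e false ⟨
      lookup (⊥ {m G}) e      ∎

  ∣δ∣≢0⇒NonTrivial : ∀ A → ∣ δ G F A ∣ ≢ 0 → NonTrivial G A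
  ∣δ∣≢0⇒NonTrivial A ∣δA∣≢0 = nonempty , λ { refl → ∣δA∣≢0 (∣δ-replicate∣≡0 true) }
    where
    nonempty : Nonempty A
    nonempty = decidable-stable (nonempty? A) λ A-empty →
      ∣δA∣≢0 (subst (λ X → ∣ δ G F X ∣ ≡ 0) (sym (Empty-unique A-empty)) (∣δ-replicate∣≡0 false))

m+n≤o+o⇒m≡o×n≡o : ∀ {m n o} → o ≤ m → o ≤ n → m + n ≤ o + o → m ≡ o × n ≡ o
m+n≤o+o⇒m≡o×n≡o {m} {n} {o} o≤m o≤n m+n≤o+o =
  ≤-antisym (+-cancelʳ-≤ o m o (≤-trans (+-monoʳ-≤ m o≤n) m+n≤o+o)) o≤m ,
  ≤-antisym (+-cancelˡ-≤ o n o (≤-trans (+-monoˡ-≤ n o≤m) m+n≤o+o)) o≤n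

p+q∸1≢0 : ∀ {p q} → 1 ≤ p → 1 ≤ q → p + q ∸ 1 ≢ 0
p+q∸1≢0 {suc p} {suc q} _ _ p+1+q≡0 = 1+n≢0 (trans (sym (+-suc p q)) p+1+q≡0)

module _ (G : MultiGraph) (p q i : ℕ) (F : Subset (m G)) (tight≢0 : p + q ∸ 1 ≢ 0)
  (safe≥i : (A : Subset (n G)) → NonTrivial G A → ∣ δ G F A ∣ ≡ p + q ∸ 1 →
    ∣ δ G (F ∩ 𝒮 G) A ∣ ≥ i)
  where

  tight-pair∈𝒞 : ∀ {A B X Y} → InC G p q i F A → InC G p q i F B →
    ∣ δ G (F ∩ 𝒮 G) X ∣ + ∣ δ G (F ∩ 𝒮 G) Y ∣ ≤ ∣ δ G (F ∩ 𝒮 G) A ∣ + ∣ δ G (F ∩ 𝒮 G) B ∣ →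
    ∣ δ G F X ∣ ≡ p + q ∸ 1 → ∣ δ G F Y ∣ ≡ p + q ∸ 1 →
    InC G p q i F X × InC G p q i F Y
  tight-pair∈𝒞 {X = X} {Y = Y} (_ , _ , ∣δₛA∣≡i) (_ , _ , ∣δₛB∣≡i) ∣δₛ∣-bound X-tight Y-tight =
    (X-nontrivial , X-tight , proj₁ safe≡i) , (Y-nontrivial , Y-tight , proj₂ safe≡i)
    where
    tight⇒NonTrivial : ∀ Z → ∣ δ G F Z ∣ ≡ p + q ∸ 1 → NonTrivial G Z
    tight⇒NonTrivial Z Z-tight = ∣δ∣≢0⇒NonTrivial G F Z (tight≢0 ∘ trans (sym Z-tight))
    X-nontrivial : NonTrivial G X
    X-nontrivial = tight⇒NonTrivial X X-tight
    Y-nontrivial : NonTrivial G Y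
    Y-nontrivial = tight⇒NonTrivial Y Y-tight
    safe≡i : ∣ δ G (F ∩ 𝒮 G) X ∣ ≡ i × ∣ δ G (F ∩ 𝒮 G) Y ∣ ≡ i
    safe≡i = m+n≤o+o⇒m≡o×n≡o (safe≥i X X-nontrivial X-tight) (safe≥i Y Y-nontrivial Y-tight)
      (subst (∣ δ G (F ∩ 𝒮 G) X ∣ + ∣ δ G (F ∩ 𝒮 G) Y ∣ ≤_) (cong₂ _+_ ∣δₛA∣≡i ∣δₛB∣≡i) ∣δₛ∣-bound)

lemma3p4 : (G : MultiGraph) (p q i : ℕ) → 1 ≤ p → 1 ≤ q → i < p →
    (F : Subset (m G)) →
    ((A : Subset (n G)) → NonTrivial G A → ∣ δ G F A ∣ ≡ p + q ∸ 1 →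
      ∣ δ G (F ∩ 𝒮 G) A ∣ ≥ i) →
    (A B : Subset (n G)) → InC G p q i F A → InC G p q i F B →
    ((∣ δ G F (A ∩ B) ∣ ≡ p + q ∸ 1 × ∣ δ G F (A ∪ B) ∣ ≡ p + q ∸ 1)
      ⊎ (∣ δ G F (A ─ B) ∣ ≡ p + q ∸ 1 × ∣ δ G F (B ─ A) ∣ ≡ p + q ∸ 1)) →
    (InC G p q i F (A ∩ B) × InC G p q i F (A ∪ B))
      ⊎ (InC G p q i F (A ─ B) × InC G p q i F (B ─ A))
lemma3p4 G p q i 1≤p 1≤q _ F safe≥i A B A∈𝒞 B∈𝒞 (inj₁ (∩-tight , ∪-tight)) =
  inj₁ (tight-pair∈𝒞 G p q i F (p+q∸1≢0 1≤p 1≤q) safe≥i A∈𝒞 B∈𝒞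
         (∣δ∣-submodular G (F ∩ 𝒮 G) A B) ∩-tight ∪-tight)
lemma3p4 G p q i 1≤p 1≤q _ F safe≥i A B A∈𝒞 B∈𝒞 (inj₂ (A─B-tight , B─A-tight)) =
  inj₂ (tight-pair∈𝒞 G p q i F (p+q∸1≢0 1≤p 1≤q) safe≥i A∈𝒞 B∈𝒞
         (∣δ∣-posimodular G (F ∩ 𝒮 G) A B) A─B-tight B─A-tight)
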